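{- Conditions (8) and (9) below are independent for bounded posets with an antitone involution: there exists a bounded poset $(P,\leq,{}',0,1)$ with an antitone involution satisfying (8) but not (9), and there exists one satisfying (9) but not (8). Here (8): $L(x,x')=L(y,y')$ for all $x,y\in P\setminus\{0,1\}$; (9): $L(x,y)\neq\{0\}$ for all $x,y\in P\setminus\{0\}$.
   Context: For a poset $(P,\leq)$, $L(x,y)=\{z\in P\mid z\leq x\text{ and }z\leq y\}$. A unary operation $'$ is antitone if $x\leq y$ implies $y'\leq x'$, and an involution if $x''=x$ for all $x$. -}

module Defs where

open import Level using (0ℓ)
open import Data.Product using (_×_; Σ)
open import Relation.Binary.Core using (Rel)
open import Relation.Binary.Structures using (IsPartialOrder)
open import Relation.Binary.PropositionalEquality using (_≡_)
open import Relation.Nullary using (¬_)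
open import Function.Bundles using (_⇔_)

record BoundedPosetAI : Set₁ where
  field
    Carrier : Set
    _≤_     : Rel Carrier 0ℓ
    isPartialOrder : IsPartialOrder _≡_ _≤_
    𝟘 𝟙     : Carrier
    bottom  : ∀ x → 𝟘 ≤ x
    top     : ∀ x → x ≤ 𝟙
    _′      : Carrier → Carrier
    antitone    : ∀ {x y} → x ≤ y → (y ′) ≤ (x ′)
    involution  : ∀ x → ((x ′) ′) ≡ x

  L : Carrier → Carrier → Carrier → Set
  L x y z = (z ≤ x) × (z ≤ y)

  Cond8 : Set
  Cond8 = ∀ x y → ¬ (x ≡ 𝟘) → ¬ (x ≡ 𝟙) → ¬ (y ≡ 𝟘) → ¬ (y ≡ 𝟙)
          → ∀ z → L x (x ′) z ⇔ L y (y ′) z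

  Cond9 : Set
  Cond9 = ∀ x y → ¬ (x ≡ 𝟘) → ¬ (y ≡ 𝟘)
          → ¬ (∀ z → L x y z ⇔ (z ≡ 𝟘))

-- Adjoining 0 and 1 to an antichain with a fixed-point-free involution gives
-- L(x,x′) = {0} for every x ∉ {0,1}: this yields (8) and refutes (9) with y = x′
-- (for the antichain {a, a′} this is the Boolean algebra 2²).  In a chain
-- L(x,y) = ↓min(x,y), so (9) holds; in the chain 0 < 1 < 2 < 3 < 4 reversed by ′,
-- 2 ∈ L(2,2′) but 2 ∉ L(1,1′) = ↓1, refuting (8).
module Submission where

open import Defs
open import Data.Bool.Base using (true; not)
open import Data.Bool.Properties using (not-¬; not-involutive)
open import Data.Fin.Base as Fin using (Fin; zero; suc; fromℕ; opposite)
open import Data.Fin.Properties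
  using (≤-isPartialOrder; ≤-total; ≤fromℕ; opposite-prop; opposite-involutive)
open import Data.Nat.Base as ℕ using (ℕ; s≤s; z≤n)
open import Data.Nat.Properties using (∸-monoʳ-≤; m≤m+n)
open import Data.Product using (_×_; Σ; _,_; proj₁)
open import Data.Empty using (⊥-elim)
open import Data.Sum using (_⊎_; inj₁; inj₂)
open import Function using (_∘_)
open import Function.Bundles using (_⇔_; mk⇔; Equivalence)
open import Function.Construct.Composition using (_⇔-∘_)
open import Function.Construct.Symmetry using (⇔-sym)
open import Relation.Binary.Definitions using (Total)
open import Relation.Binary.Structures using (IsPartialOrder)
open import Relation.Binary.PropositionalEquality
  using (_≡_; _≢_; refl; sym; trans; cong; subst; isEquivalence)
open import Relation.Nullary using (¬_)

module Conditions (P : BoundedPosetAI) where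
  open BoundedPosetAI P
  open IsPartialOrder isPartialOrder using (antisym) renaming (refl to ≤-refl)

  Disjoint : Carrier → Carrier → Set
  Disjoint x y = ∀ z → L x y z ⇔ (z ≡ 𝟘)

  𝟘′≡𝟙 : 𝟘 ′ ≡ 𝟙
  𝟘′≡𝟙 = antisym (top (𝟘 ′)) (subst (_≤ (𝟘 ′)) (involution 𝟙) (antitone (bottom (𝟙 ′))))

  ′≡𝟘⇒≡𝟙 : ∀ {x} → x ′ ≡ 𝟘 → x ≡ 𝟙
  ′≡𝟘⇒≡𝟙 {x} x′≡𝟘 = trans (sym (involution x)) (trans (cong _′ x′≡𝟘) 𝟘′≡𝟙)

  cond8-if-disjoint-from-complements :
    (∀ x → x ≢ 𝟘 → x ≢ 𝟙 → Disjoint x (x ′)) → Cond8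
  cond8-if-disjoint-from-complements disj x y x≢𝟘 x≢𝟙 y≢𝟘 y≢𝟙 z =
    ⇔-sym (disj y y≢𝟘 y≢𝟙 z) ⇔-∘ disj x x≢𝟘 x≢𝟙 z

  ¬cond9-if-disjoint-from-complement :
    ∀ {x} → x ≢ 𝟘 → x ≢ 𝟙 → Disjoint x (x ′) → ¬ Cond9
  ¬cond9-if-disjoint-from-complement x≢𝟘 x≢𝟙 disj cond9 =
    cond9 _ _ x≢𝟘 (x≢𝟙 ∘ ′≡𝟘⇒≡𝟙) disj

  cond9-if-total : Total _≤_ → Cond9
  cond9-if-total total x y x≢𝟘 y≢𝟘 disj with total x y
  ... | inj₁ x≤y = x≢𝟘 (Equivalence.to (disj x) (≤-refl , x≤y))
  ... | inj₂ y≤x = y≢𝟘 (Equivalence.to (disj y) (y≤x , ≤-refl))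

  ¬cond8-if : ∀ {x y} → x ≢ 𝟘 → x ≢ 𝟙 → y ≢ 𝟘 → y ≢ 𝟙 →
              y ≤ (y ′) → ¬ y ≤ x → ¬ Cond8
  ¬cond8-if x≢𝟘 x≢𝟙 y≢𝟘 y≢𝟙 y≤y′ y≰x cond8 =
    y≰x (proj₁ (Equivalence.from (cond8 _ _ x≢𝟘 x≢𝟙 y≢𝟘 y≢𝟙 _) (≤-refl , y≤y′)))

open Conditions
open BoundedPosetAI using (Cond8; Cond9)

module AntichainWithBounds {A : Set} (σ : A → A) (σ-involutive : ∀ a → σ (σ a) ≡ a) where

  data WithBounds : Set where
    𝟎 𝟏 : WithBounds
    ⟨_⟩ : A → WithBounds

  ⟨⟩-injective : ∀ {a b} → ⟨ a ⟩ ≡ ⟨ b ⟩ → a ≡ b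
  ⟨⟩-injective refl = refl

  infix 4 _⊑_
  data _⊑_ : WithBounds → WithBounds → Set where
    𝟎⊑     : ∀ {x} → 𝟎 ⊑ x
    ⊑𝟏     : ∀ {x} → x ⊑ 𝟏
    ⊑-refl : ∀ {x} → x ⊑ x

  ⊑-trans : ∀ {x y z} → x ⊑ y → y ⊑ z → x ⊑ z
  ⊑-trans 𝟎⊑     _      = 𝟎⊑
  ⊑-trans _      ⊑𝟏     = ⊑𝟏
  ⊑-trans ⊑-refl y⊑z    = y⊑z
  ⊑-trans x⊑y    ⊑-refl = x⊑y

  ⊑-antisym : ∀ {x y} → x ⊑ y → y ⊑ x → x ≡ y
  ⊑-antisym ⊑-refl _      = refl
  ⊑-antisym _      ⊑-refl = refl
  ⊑-antisym 𝟎⊑     𝟎⊑     = refl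
  ⊑-antisym ⊑𝟏     ⊑𝟏     = refl

  _ᶜ : WithBounds → WithBounds
  𝟎 ᶜ     = 𝟏
  𝟏 ᶜ     = 𝟎
  ⟨ a ⟩ ᶜ = ⟨ σ a ⟩

  ᶜ-antitone : ∀ {x y} → x ⊑ y → y ᶜ ⊑ x ᶜ
  ᶜ-antitone 𝟎⊑     = ⊑𝟏
  ᶜ-antitone ⊑𝟏     = 𝟎⊑
  ᶜ-antitone ⊑-refl = ⊑-refl

  ᶜ-involutive : ∀ x → (x ᶜ) ᶜ ≡ x
  ᶜ-involutive 𝟎     = refl
  ᶜ-involutive 𝟏     = refl
  ᶜ-involutive ⟨ a ⟩ = cong ⟨_⟩ (σ-involutive a)

  poset : BoundedPosetAI
  poset = record
    { Carrier        = WithBounds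
    ; _≤_            = _⊑_
    ; isPartialOrder = record
      { isPreorder = record
        { isEquivalence = isEquivalence
        ; reflexive     = λ { refl → ⊑-refl }
        ; trans         = ⊑-trans
        }
      ; antisym    = ⊑-antisym
      }
    ; 𝟘          = 𝟎
    ; 𝟙          = 𝟏
    ; bottom     = λ _ → 𝟎⊑
    ; top        = λ _ → ⊑𝟏
    ; _′         = _ᶜ
    ; antitone   = ᶜ-antitone
    ; involution = ᶜ-involutive
    }

  ⊑⟨⟩-inversion : ∀ {z a} → z ⊑ ⟨ a ⟩ → z ≡ 𝟎 ⊎ z ≡ ⟨ a ⟩
  ⊑⟨⟩-inversion 𝟎⊑     = inj₁ refl
  ⊑⟨⟩-inversion ⊑-refl = inj₂ refl

  module _ (σ-fixpoint-free : ∀ a → a ≢ σ a) where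

    ⟨⟩-disjoint-from-complement : ∀ a → Disjoint poset ⟨ a ⟩ (⟨ a ⟩ ᶜ)
    ⟨⟩-disjoint-from-complement a z = mk⇔ to (λ { refl → 𝟎⊑ , 𝟎⊑ })
      where
      to : z ⊑ ⟨ a ⟩ × z ⊑ ⟨ σ a ⟩ → z ≡ 𝟎
      to (z⊑a , z⊑σa) with ⊑⟨⟩-inversion z⊑a | ⊑⟨⟩-inversion z⊑σa
      ... | inj₁ z≡𝟎  | _         = z≡𝟎
      ... | inj₂ _    | inj₁ z≡𝟎  = z≡𝟎
      ... | inj₂ refl | inj₂ a≡σa = ⊥-elim (σ-fixpoint-free a (⟨⟩-injective a≡σa))

    cond8 : Cond8 poset
    cond8 = cond8-if-disjoint-from-complements poset disj
      where
      disj : ∀ x → x ≢ 𝟎 → x ≢ 𝟏 → Disjoint poset x (x ᶜ)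
      disj 𝟎     x≢𝟎 _   = ⊥-elim (x≢𝟎 refl)
      disj 𝟏     _   x≢𝟏 = ⊥-elim (x≢𝟏 refl)
      disj ⟨ a ⟩ _   _   = ⟨⟩-disjoint-from-complement a

    ¬cond9 : A → ¬ Cond9 poset
    ¬cond9 a = ¬cond9-if-disjoint-from-complement poset (λ ()) (λ ())
                 (⟨⟩-disjoint-from-complement a)

opposite-antitone : ∀ {n} {i j : Fin n} → i Fin.≤ j → opposite j Fin.≤ opposite i
opposite-antitone {ℕ.suc n} {i} {j} i≤j
  rewrite opposite-prop i | opposite-prop j = ∸-monoʳ-≤ (ℕ.suc n) (s≤s i≤j)

chain : ℕ → BoundedPosetAI
chain n = record
  { Carrier        = Fin (ℕ.suc n)
  ; _≤_            = Fin._≤_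
  ; isPartialOrder = ≤-isPartialOrder
  ; 𝟘              = zero
  ; 𝟙              = fromℕ n
  ; bottom         = λ _ → z≤n
  ; top            = ≤fromℕ
  ; _′             = opposite
  ; antitone       = opposite-antitone
  ; involution     = opposite-involutive
  }

chain-cond9 : ∀ n → Cond9 (chain n)
chain-cond9 n = cond9-if-total (chain n) ≤-total

chain-¬cond8 : ∀ n → ¬ Cond8 (chain (4 ℕ.+ n))
chain-¬cond8 n = ¬cond8-if (chain (4 ℕ.+ n)) {x = one} {y = two}
  (λ ()) (λ ()) (λ ()) (λ ()) two≤two′ λ { (s≤s ()) }
  where
  one two : Fin (5 ℕ.+ n)
  one = suc zero
  two = suc (suc zero)

  two≤two′ : two Fin.≤ opposite two
  two≤two′ = subst (2 ℕ.≤_) (sym (opposite-prop two)) (m≤m+n 2 n)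

mainTheorem2 : Σ BoundedPosetAI (λ P → BoundedPosetAI.Cond8 P × ¬ BoundedPosetAI.Cond9 P)
               × Σ BoundedPosetAI (λ P → BoundedPosetAI.Cond9 P × ¬ BoundedPosetAI.Cond8 P)
mainTheorem2 =
  (Boolean₂.poset , Boolean₂.cond8 not≢ , Boolean₂.¬cond9 not≢ true) ,
  (chain 4 , chain-cond9 4 , chain-¬cond8 0)
  where
  module Boolean₂ = AntichainWithBounds not not-involutive

  not≢ : ∀ b → b ≢ not b
  not≢ b = not-¬ refl
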